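{- There is an absolute constant $\kappa>0$ such that for every $\varepsilon\in(0,1/4)$ the following holds: if $\beta$ is such that every instance of the coloured bin packing problem admits a $(1+\varepsilon,\beta)$-approximate packing, then $\beta\ge \kappa/\varepsilon$. That is, with bin stretch $1+\varepsilon$ it is impossible to achieve colour stretch better than $\Omega(1/\varepsilon)$.
   Context: Coloured bin packing: an instance $I$ is a finite set of items, each item $e$ having a size $s(e)\in(0,1]$ and a colour $c(e)\in C=\{1,\dots,m\}$; items are to be packed into unit-capacity bins (the total size of items in a bin is at most $1$). $I_c$ denotes the set of items of colour $c$. $\mathrm{OPT}(I)$ (resp. $\mathrm{OPT}(I_c)$) is the minimum number of bins needed to pack $I$ (resp. $I_c$). For a packing $P$ of $I$, $P(I)$ is the number of bins used and $P_c(I)$ is the number of bins containing at least one item of colour $c$. A packing is $(\alpha,\beta)$-approximate if $P(I)\le \alpha\,\mathrm{OPT}(I)+O(1)$ and $P_c(I)\le \beta\,\mathrm{OPT}(I_c)+O(1)$ for every colour $c$, where the additive constants are independent of the instance ($\alpha$ is called the bin stretch, $\beta$ the colour stretch).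
   Formalization: The parameters ε and β range over the rationals, and the item sizes and the constant κ are taken in ℚ. -}

module Defs where

open import Data.Nat as ℕ using (ℕ)
open import Data.Integer using (+_)
open import Data.Rational using (ℚ; 0ℚ; 1ℚ; _≤_; _<_; _+_; _*_; _/_)
open import Data.Product using (Σ; ∃; _×_)
open import Data.List using (List; length; filter; concat; foldr)
open import Data.List.Relation.Binary.Permutation.Propositional using (_↭_)
open import Data.List.Relation.Unary.All using (All)
open import Data.List.Relation.Unary.Any using (any?)
open import Relation.Binary.PropositionalEquality using (_≡_)

⟦_⟧ : ℕ → ℚ
⟦ n ⟧ = + n / 1

record Item : Set where
  constructor item
  field
    size   : ℚ
    colour : ℕ
open Item public

-- An instance is a finite multiset (list) of items.
Instance : Set
Instance = List Item

ValidItem : Item → Set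
ValidItem e = (0ℚ < size e) × (size e ≤ 1ℚ)

ValidInstance : Instance → Set
ValidInstance I = All ValidItem I

Bin : Set
Bin = List Item

load : Bin → ℚ
load = foldr (λ e r → size e + r) 0ℚ

record Packing (I : Instance) : Set where
  field
    bins   : List Bin
    covers : concat bins ↭ I
    fits   : All (λ b → load b ≤ 1ℚ) bins
open Packing public

numBins : ∀ {I} → Packing I → ℕ
numBins P = length (bins P)

colourClass : ℕ → Instance → Instance
colourClass c I = filter (λ e → colour e ℕ.≟ c) I

numBinsWithColour : ∀ {I} → ℕ → Packing I → ℕ
numBinsWithColour c P = length (filter (any? (λ e → colour e ℕ.≟ c)) (bins P))

IsOPT : Instance → ℕ → Set
IsOPT I n = (Σ (Packing I) (λ P → numBins P ≡ n)) × (∀ (P : Packing I) → n ℕ.≤ numBins P)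

IsApprox : ℚ → ℚ → ℕ → (I : Instance) → Packing I → Set
IsApprox α β K I P =
  (∀ n → IsOPT I n → ⟦ numBins P ⟧ ≤ α * ⟦ n ⟧ + ⟦ K ⟧) ×
  (∀ c n → IsOPT (colourClass c I) n → ⟦ numBinsWithColour c P ⟧ ≤ β * ⟦ n ⟧ + ⟦ K ⟧)

AllAdmit : ℚ → ℚ → Set
AllAdmit α β = ∃ λ (K : ℕ) → ∀ (I : Instance) → ValidInstance I → Σ (Packing I) (IsApprox α β K I)

module Submission where

-- Given 0 < ε < 1/4 take p = ⌊1/(2ε)⌋ ≥ 2 and q = p + 1.  The hard instance has
-- n pairs of a big item (size p/q, colour 0) and a small item (size 1/q,
-- colour 1).  Weighing items by their size in units of 1/q, a bin weighs at
-- most q, and a bin without small items holds at most one big item, so weighs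
-- at most p.  Hence OPT(I) = n, the small items alone (n = m·q) have OPT = m,
-- and every packing satisfies the counting inequality  n·q ≤ p·P(I) + P₁(I).
-- With m = 4K + 1 (K the additive constant), inserting P(I) ≤ (1+ε)n + K and
-- P₁(I) ≤ βm + K and using pεn ≤ n/2 gives n/2 ≤ qK + βm, whence
-- β ≥ q/4 ≥ 1/(8ε).

open import Defs
open import Data.Integer using (+_)
open import Data.Rational using (ℚ; 0ℚ; 1ℚ; _≤_; _<_; _+_; _/_; _÷_; >-nonZero)
open import Data.Product using (∃; _×_)

open import Data.Nat as ℕ using (ℕ; zero; suc; z≤n; s≤s)
import Data.Nat.Properties as ℕP
import Data.Integer as ℤ
import Data.Integer.Properties as ℤP
open import Data.Rational using (_*_; -_; 1/_; mkℚ; toℚᵘ; *<*; NonZero; NonNegative; Positive; nonNegative; positive)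
import Data.Rational.Properties as ℚP
import Data.Rational.Unnormalised as ℚᵘ
import Data.Rational.Unnormalised.Properties as ℚᵘP
open import Data.Rational.Solver using (module +-*-Solver)
import Data.Nat.Coprimality as Coprimality
open import Data.Nat.Coprimality using (Coprime)
import Data.Nat.DivMod as DivMod
import Data.Nat.Solver as ℕSolver
open import Data.Empty using (⊥-elim)
open import Data.Product using (Σ; _,_; proj₁; proj₂)
open import Data.List using (List; []; _∷_; _++_; concat; map; replicate; length; filter)
import Data.List.Properties as ListP
open import Data.List.Relation.Unary.All as All using (All; []; _∷_)
import Data.List.Relation.Unary.All.Properties as AllP
open import Data.List.Relation.Unary.Any using (Any; here; there; any?)
open import Data.List.Relation.Binary.Permutation.Propositional using (↭-refl; ↭-sym)
import Data.List.Relation.Binary.Permutation.Propositional.Properties as ↭P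
open import Data.Nat.ListAction using (sum)
import Data.Nat.ListAction.Properties as SumP
open import Function using (_∘_)
open import Relation.Nullary using (¬_; Dec; yes; no)
open import Relation.Binary.PropositionalEquality using (_≡_; refl; sym; trans; cong; cong₂; subst; subst₂; module ≡-Reasoning)

-- ℕ inside ℚ: ⟦_⟧ is an embedding of ordered semirings.  The algebraic laws are
-- checked on unreduced fractions, where ⟦ n ⟧ is literally n/1.

toℚᵘ-⟦⟧ : ∀ n → toℚᵘ ⟦ n ⟧ ≡ ℚᵘ.mkℚᵘ (+ n) 0
toℚᵘ-⟦⟧ n = cong toℚᵘ (ℚP.normalize-coprime (Coprimality.sym (Coprimality.1-coprimeTo n)))

⟦⟧-+ : ∀ m n → ⟦ m ℕ.+ n ⟧ ≡ ⟦ m ⟧ + ⟦ n ⟧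
⟦⟧-+ m n = ℚP.toℚᵘ-injective (begin
  toℚᵘ ⟦ m ℕ.+ n ⟧                                 ≡⟨ toℚᵘ-⟦⟧ (m ℕ.+ n) ⟩
  ℚᵘ.mkℚᵘ (+ (m ℕ.+ n)) 0                          ≈⟨ ℚᵘ.*≡* (cong (ℤ._* + 1) numerators) ⟩
  ℚᵘ.mkℚᵘ (+ m) 0 ℚᵘ.+ ℚᵘ.mkℚᵘ (+ n) 0             ≡⟨ cong₂ ℚᵘ._+_ (toℚᵘ-⟦⟧ m) (toℚᵘ-⟦⟧ n) ⟨
  toℚᵘ ⟦ m ⟧ ℚᵘ.+ toℚᵘ ⟦ n ⟧                       ≈⟨ ℚP.toℚᵘ-homo-+ ⟦ m ⟧ ⟦ n ⟧ ⟨
  toℚᵘ (⟦ m ⟧ + ⟦ n ⟧)                             ∎)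
  where
  open ℚᵘP.≃-Reasoning
  numerators : + (m ℕ.+ n) ≡ + m ℤ.* + 1 ℤ.+ + n ℤ.* + 1
  numerators = trans (ℤP.pos-+ m n) (sym (cong₂ ℤ._+_ (ℤP.*-identityʳ (+ m)) (ℤP.*-identityʳ (+ n))))

⟦⟧-* : ∀ m n → ⟦ m ℕ.* n ⟧ ≡ ⟦ m ⟧ * ⟦ n ⟧
⟦⟧-* m n = ℚP.toℚᵘ-injective (begin
  toℚᵘ ⟦ m ℕ.* n ⟧                                 ≡⟨ toℚᵘ-⟦⟧ (m ℕ.* n) ⟩
  ℚᵘ.mkℚᵘ (+ (m ℕ.* n)) 0                          ≈⟨ ℚᵘ.*≡* (cong (ℤ._* + 1) (ℤP.pos-* m n)) ⟩
  ℚᵘ.mkℚᵘ (+ m) 0 ℚᵘ.* ℚᵘ.mkℚᵘ (+ n) 0             ≡⟨ cong₂ ℚᵘ._*_ (toℚᵘ-⟦⟧ m) (toℚᵘ-⟦⟧ n) ⟨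
  toℚᵘ ⟦ m ⟧ ℚᵘ.* toℚᵘ ⟦ n ⟧                       ≈⟨ ℚP.toℚᵘ-homo-* ⟦ m ⟧ ⟦ n ⟧ ⟨
  toℚᵘ (⟦ m ⟧ * ⟦ n ⟧)                             ∎)
  where open ℚᵘP.≃-Reasoning

⟦⟧-nonNeg : ∀ n → NonNegative ⟦ n ⟧
⟦⟧-nonNeg n = ℚP.normalize-nonNeg n 1

⟦suc⟧-pos : ∀ n → Positive ⟦ suc n ⟧
⟦suc⟧-pos n = ℚP.normalize-pos (suc n) 1

x≤x+y : ∀ x {y} → 0ℚ ≤ y → x ≤ x + y
x≤x+y x {y} 0≤y = subst (_≤ x + y) (ℚP.+-identityʳ x) (ℚP.+-monoʳ-≤ x 0≤y)

x<x+y : ∀ x {y} → 0ℚ < y → x < x + y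
x<x+y x {y} 0<y = subst (_< x + y) (ℚP.+-identityʳ x) (ℚP.+-monoʳ-< x 0<y)

⟦⟧-mono-≤ : ∀ {m n} → m ℕ.≤ n → ⟦ m ⟧ ≤ ⟦ n ⟧
⟦⟧-mono-≤ {m} {n} m≤n = subst (⟦ m ⟧ ≤_) n≡m+k (x≤x+y ⟦ m ⟧ (ℚP.nonNegative⁻¹ ⟦ n ℕ.∸ m ⟧ {{⟦⟧-nonNeg (n ℕ.∸ m)}}))
  where
  n≡m+k : ⟦ m ⟧ + ⟦ n ℕ.∸ m ⟧ ≡ ⟦ n ⟧
  n≡m+k = trans (sym (⟦⟧-+ m (n ℕ.∸ m))) (cong ⟦_⟧ (ℕP.m+[n∸m]≡n m≤n))

⟦⟧-mono-< : ∀ {m n} → m ℕ.< n → ⟦ m ⟧ < ⟦ n ⟧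
⟦⟧-mono-< {m} {n} m<n = ℚP.<-≤-trans m<1+m (⟦⟧-mono-≤ m<n)
  where
  m<1+m : ⟦ m ⟧ < ⟦ suc m ⟧
  m<1+m = subst (⟦ m ⟧ <_) (trans (sym (⟦⟧-+ m 1)) (cong ⟦_⟧ (ℕP.+-comm m 1)))
            (x<x+y ⟦ m ⟧ (ℚP.positive⁻¹ ⟦ 1 ⟧ {{⟦suc⟧-pos 0}}))

⟦⟧-cancel-≤ : ∀ {m n} → ⟦ m ⟧ ≤ ⟦ n ⟧ → m ℕ.≤ n
⟦⟧-cancel-≤ {m} {n} ⟦m⟧≤⟦n⟧ with m ℕ.≤? n
... | yes m≤n = m≤n
... | no m≰n = ⊥-elim (ℚP.<-irrefl refl (ℚP.<-≤-trans (⟦⟧-mono-< (ℕP.≰⇒> m≰n)) ⟦m⟧≤⟦n⟧))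

replicate-++ : ∀ {A : Set} m n (x : A) → replicate (m ℕ.+ n) x ≡ replicate m x ++ replicate n x
replicate-++ zero    n x = refl
replicate-++ (suc m) n x = cong (x ∷_) (replicate-++ m n x)

concat-replicate : ∀ {A : Set} m k (x : A) → concat (replicate m (replicate k x)) ≡ replicate (m ℕ.* k) x
concat-replicate zero    k x = refl
concat-replicate (suc m) k x =
  trans (cong (replicate k x ++_) (concat-replicate m k x)) (sym (replicate-++ k (m ℕ.* k) x))

sum-constant : ∀ {A : Set} (f : A → ℕ) {c} xs → All (λ x → f x ≡ c) xs → sum (map f xs) ≡ length xs ℕ.* c
sum-constant f []       []          = refl
sum-constant f (x ∷ xs) (fx≡c ∷ eqs) = cong₂ ℕ._+_ fx≡c (sum-constant f xs eqs)

module Weighting (wt : Item → ℕ) where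

  weight : List Item → ℕ
  weight = sum ∘ map wt

  weight-++ : ∀ xs ys → weight (xs ++ ys) ≡ weight xs ℕ.+ weight ys
  weight-++ xs ys = trans (cong sum (ListP.map-++ wt xs ys)) (SumP.sum-++ (map wt xs) (map wt ys))

  weight-concat : ∀ bs → weight (concat bs) ≡ sum (map weight bs)
  weight-concat []       = refl
  weight-concat (b ∷ bs) = trans (weight-++ b (concat bs)) (cong (weight b ℕ.+_) (weight-concat bs))

  packingWeight : ∀ {I} (P : Packing I) → sum (map weight (bins P)) ≡ weight I
  packingWeight P = trans (sym (weight-concat (bins P))) (SumP.sum-↭ (↭P.map⁺ wt (covers P)))

-- The hard instance

module HardInstance (p : ℕ) (2≤p : 2 ℕ.≤ p) where

  q : ℕ
  q = suc p

  instance
    ⟦q⟧-pos : Positive ⟦ q ⟧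
    ⟦q⟧-pos = ⟦suc⟧-pos p

    ⟦q⟧-nonZero : NonZero ⟦ q ⟧
    ⟦q⟧-nonZero = ℚP.pos⇒nonZero ⟦ q ⟧

  unit : ℚ
  unit = 1/ ⟦ q ⟧

  instance
    unit-pos : Positive unit
    unit-pos = ℚP.1/pos⇒pos ⟦ q ⟧

    unit-nonNeg : NonNegative unit
    unit-nonNeg = ℚP.pos⇒nonNeg unit

  q·unit : ⟦ q ⟧ * unit ≡ 1ℚ
  q·unit = ℚP.*-inverseʳ ⟦ q ⟧

  big small : Item
  big   = item (⟦ p ⟧ * unit) 0
  small = item (⟦ 1 ⟧ * unit) 1

  wt : Item → ℕ
  wt e with colour e ℕ.≟ 1
  ... | yes _ = 1
  ... | no  _ = p

  open Weighting wt public

  data Basic : Item → Set where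
    isBig   : Basic big
    isSmall : Basic small

  size-Basic : ∀ {e} → Basic e → size e ≡ ⟦ wt e ⟧ * unit
  size-Basic isBig   = refl
  size-Basic isSmall = refl

  load-Basic : ∀ {b} → All Basic b → load b ≡ ⟦ weight b ⟧ * unit
  load-Basic []                       = sym (ℚP.*-zeroˡ unit)
  load-Basic {e ∷ b} (basic ∷ basics) = begin
    size e + load b                        ≡⟨ cong₂ _+_ (size-Basic basic) (load-Basic basics) ⟩
    ⟦ wt e ⟧ * unit + ⟦ weight b ⟧ * unit  ≡⟨ ℚP.*-distribʳ-+ unit ⟦ wt e ⟧ ⟦ weight b ⟧ ⟨
    (⟦ wt e ⟧ + ⟦ weight b ⟧) * unit       ≡⟨ cong (_* unit) (⟦⟧-+ (wt e) (weight b)) ⟨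
    ⟦ weight (e ∷ b) ⟧ * unit              ∎
    where open ≡-Reasoning

  capacity : ∀ {b} → All Basic b → load b ≤ 1ℚ → weight b ℕ.≤ q
  capacity basics fits =
    ⟦⟧-cancel-≤ (ℚP.*-cancelʳ-≤-pos unit (subst₂ _≤_ (load-Basic basics) (sym q·unit) fits))

  fullBin : ∀ {b} → All Basic b → weight b ≡ q → load b ≤ 1ℚ
  fullBin basics w≡q = ℚP.≤-reflexive (trans (load-Basic basics) (trans (cong (λ w → ⟦ w ⟧ * unit) w≡q) q·unit))

  -- two big items weigh 2p > q, so a feasible bin without small items weighs at most p
  bigOnly : ∀ {b} → All Basic b → ¬ Any (λ e → colour e ≡ 1) b → weight b ℕ.≤ q → weight b ℕ.≤ p
  bigOnly []                      _       _   = z≤n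
  bigOnly (isSmall ∷ _)           noSmall _   = ⊥-elim (noSmall (here refl))
  bigOnly (isBig ∷ [])            _       _   = ℕP.≤-reflexive (ℕP.+-identityʳ p)
  bigOnly (isBig ∷ isSmall ∷ _)   noSmall _   = ⊥-elim (noSmall (there (here refl)))
  bigOnly {_ ∷ _ ∷ b} (isBig ∷ isBig ∷ _) _ w≤q = ⊥-elim (ℕP.<⇒≱ 2≤p p≤1)
    where
    p≤1 : p ℕ.≤ 1
    p≤1 = ℕP.+-cancelˡ-≤ p p 1 (ℕP.≤-trans (ℕP.+-monoʳ-≤ p (ℕP.m≤m+n p (weight b)))
                                 (ℕP.≤-trans w≤q (ℕP.≤-reflexive (ℕP.+-comm 1 p))))

  -- the decision procedure by which P₁ counts the bins containing colour 1
  hasSmall? : (b : Bin) → Dec (Any (λ e → colour e ≡ 1) b)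
  hasSmall? = any? (λ e → colour e ℕ.≟ 1)

  -- bins with a small item weigh at most p + 1, the others at most p
  binsBound : ∀ bs → All (All Basic) bs → All (λ b → load b ≤ 1ℚ) bs →
              sum (map weight bs) ℕ.≤ length bs ℕ.* p ℕ.+ length (filter hasSmall? bs)
  binsBound []       []               []            = z≤n
  binsBound (b ∷ bs) (basics ∷ basicss) (fits ∷ fitss) with hasSmall? b
  ... | yes _       = ℕP.≤-trans (ℕP.+-mono-≤ (capacity basics fits) (binsBound bs basicss fitss))
                        (ℕP.≤-reflexive (trans (cong suc (sym (ℕP.+-assoc p _ _))) (sym (ℕP.+-suc (p ℕ.+ _) _))))
  ... | no noSmall = ℕP.≤-trans (ℕP.+-mono-≤ (bigOnly basics noSmall (capacity basics fits)) (binsBound bs basicss fitss))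
                        (ℕP.≤-reflexive (sym (ℕP.+-assoc p _ _)))

  basicBins : ∀ {I} → All Basic I → (P : Packing I) → All (All Basic) (bins P)
  basicBins basics P = AllP.concat⁻ (↭P.All-resp-↭ (↭-sym (covers P)) basics)

  colourBound : ∀ {I} → All Basic I → (P : Packing I) →
                weight I ℕ.≤ numBins P ℕ.* p ℕ.+ numBinsWithColour 1 P
  colourBound basics P = subst (ℕ._≤ _) (packingWeight P) (binsBound (bins P) (basicBins basics P) (fits P))

  binCountBound : ∀ {I} → All Basic I → (P : Packing I) → weight I ℕ.≤ numBins P ℕ.* q
  binCountBound basics P = ℕP.≤-trans (colourBound basics P) (begin
    numBins P ℕ.* p ℕ.+ numBinsWithColour 1 P  ≤⟨ ℕP.+-monoʳ-≤ (numBins P ℕ.* p) (ListP.length-filter hasSmall? (bins P)) ⟩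
    numBins P ℕ.* p ℕ.+ numBins P              ≡⟨ ℕP.+-comm (numBins P ℕ.* p) (numBins P) ⟩
    numBins P ℕ.+ numBins P ℕ.* p              ≡⟨ ℕP.*-suc (numBins P) p ⟨
    numBins P ℕ.* q                            ∎)
    where open ℕP.≤-Reasoning

  fullWeight : ∀ bs → All (λ b → weight b ≡ q) bs → weight (concat bs) ≡ length bs ℕ.* q
  fullWeight bs full = trans (weight-concat bs) (sum-constant weight bs full)

  fullPackingOptimal : ∀ bs → All (All Basic) bs → All (λ b → weight b ≡ q) bs → IsOPT (concat bs) (length bs)
  fullPackingOptimal bs basics full = (packing , refl) , optimal
    where
    packing : Packing (concat bs)
    packing = record { bins = bs ; covers = ↭-refl
                     ; fits = All.zipWith (λ (basic , w≡q) → fullBin basic w≡q) (basics , full) }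
    optimal : ∀ P → length bs ℕ.≤ numBins P
    optimal P = ℕP.*-cancelʳ-≤ (length bs) (numBins P) q
                  (subst (ℕ._≤ numBins P ℕ.* q) (fullWeight bs full) (binCountBound (AllP.concat⁺ basics) P))

  pair : Bin
  pair = big ∷ small ∷ []

  pair-full : weight pair ≡ q
  pair-full = trans (ℕP.+-suc p 0) (cong suc (ℕP.+-identityʳ p))

  hardInstance : ℕ → Instance
  hardInstance n = concat (replicate n pair)

  pairs-basic : ∀ n → All (All Basic) (replicate n pair)
  pairs-basic n = AllP.replicate⁺ n (isBig ∷ isSmall ∷ [])

  unitMultiple-valid : ∀ k c → 0 ℕ.< k → k ℕ.≤ q → ValidItem (item (⟦ k ⟧ * unit) c)
  unitMultiple-valid k c 0<k k≤q =
    subst (_< ⟦ k ⟧ * unit) (ℚP.*-zeroˡ unit) (ℚP.*-monoˡ-<-pos unit (⟦⟧-mono-< 0<k)) ,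
    subst (⟦ k ⟧ * unit ≤_) q·unit (ℚP.*-monoʳ-≤-nonNeg unit (⟦⟧-mono-≤ k≤q))

  hardInstance-valid : ∀ n → ValidInstance (hardInstance n)
  hardInstance-valid n = AllP.concat⁺ (AllP.replicate⁺ n
    (unitMultiple-valid p 0 (ℕP.<-≤-trans (s≤s z≤n) 2≤p) (ℕP.n≤1+n p) ∷ unitMultiple-valid 1 1 (s≤s z≤n) (s≤s z≤n) ∷ []))

  hardInstance-OPT : ∀ n → IsOPT (hardInstance n) n
  hardInstance-OPT n = subst (IsOPT (hardInstance n)) (ListP.length-replicate n)
    (fullPackingOptimal (replicate n pair) (pairs-basic n) (AllP.replicate⁺ n pair-full))

  hardInstance-colourBound : ∀ n (P : Packing (hardInstance n)) →
                             n ℕ.* q ℕ.≤ numBins P ℕ.* p ℕ.+ numBinsWithColour 1 P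
  hardInstance-colourBound n P = subst (ℕ._≤ numBins P ℕ.* p ℕ.+ numBinsWithColour 1 P) totalWeight
    (colourBound (AllP.concat⁺ (pairs-basic n)) P)
    where
    totalWeight : weight (hardInstance n) ≡ n ℕ.* q
    totalWeight = trans (fullWeight (replicate n pair) (AllP.replicate⁺ n pair-full))
                        (cong (ℕ._* q) (ListP.length-replicate n))

  smallClass : ∀ n → colourClass 1 (hardInstance n) ≡ replicate n small
  smallClass zero    = refl
  smallClass (suc n) = cong (small ∷_) (smallClass n)

  smallClass-OPT : ∀ m → IsOPT (colourClass 1 (hardInstance (m ℕ.* q))) m
  smallClass-OPT m = subst₂ IsOPT (trans (concat-replicate m q small) (sym (smallClass (m ℕ.* q)))) (ListP.length-replicate m)
    (fullPackingOptimal (replicate m (replicate q small))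
      (AllP.replicate⁺ m (AllP.replicate⁺ q isSmall)) (AllP.replicate⁺ m (smalls-weight q)))
    where
    smalls-weight : ∀ k → weight (replicate k small) ≡ k
    smalls-weight zero    = refl
    smalls-weight (suc k) = cong suc (smalls-weight k)

half quarter eighth two four : ℚ
half    = + 1 / 2
quarter = + 1 / 4
eighth  = + 1 / 8
two     = + 2 / 1
four    = + 4 / 1

+-cancelˡ-≤ : ∀ c {x y} → c + x ≤ c + y → x ≤ y
+-cancelˡ-≤ c {x} {y} c+x≤c+y = subst₂ _≤_ (undo x) (undo y) (ℚP.+-monoʳ-≤ (- c) c+x≤c+y)
  where
  undo : ∀ z → - c + (c + z) ≡ z
  undo z = trans (sym (ℚP.+-assoc (- c) c z)) (trans (cong (_+ z) (ℚP.+-inverseˡ c)) (ℚP.+-identityˡ z))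

-- Combining the counting inequality N(1+P) ≤ BP + C with the approximation
-- guarantees for B = P(I) and C = P₁(I): what survives of N is its ε-excess.
excessBound : ∀ {P ε N B C K β M} → 0ℚ ≤ P →
              N * (1ℚ + P) ≤ B * P + C → B ≤ (1ℚ + ε) * N + K → C ≤ β * M + K →
              N ≤ (P * ε) * N + ((1ℚ + P) * K + β * M)
excessBound {P} {ε} {N} {B} {C} {K} {β} {M} 0≤P counting binsApprox colourApprox =
  +-cancelˡ-≤ (P * N) (begin
    P * N + N                                          ≡⟨ solve 2 (λ P N → P :* N :+ N := N :* (con 1ℚ :+ P)) refl P N ⟩
    N * (1ℚ + P)                                       ≤⟨ counting ⟩
    B * P + C                                          ≤⟨ ℚP.+-mono-≤ (ℚP.*-monoʳ-≤-nonNeg P {{nonNegative 0≤P}} binsApprox) colourApprox ⟩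
    ((1ℚ + ε) * N + K) * P + (β * M + K)               ≡⟨ solve 6 (λ P ε N K β M →
                                                              ((con 1ℚ :+ ε) :* N :+ K) :* P :+ (β :* M :+ K)
                                                           := P :* N :+ ((P :* ε) :* N :+ ((con 1ℚ :+ P) :* K :+ β :* M)))
                                                           refl P ε N K β M ⟩
    P * N + ((P * ε) * N + ((1ℚ + P) * K + β * M))     ∎)
  where
  open ℚP.≤-Reasoning
  open +-*-Solver using (solve; _:=_; _:+_; _:*_; con)

halve : ∀ {N P ε S} → 0ℚ ≤ N → two * P * ε ≤ 1ℚ → N ≤ (P * ε) * N + S → N * half ≤ S
halve {N} {P} {ε} {S} 0≤N 2Pε≤1 excess = +-cancelˡ-≤ (N * half) (begin
  N * half + N * half             ≡⟨ solve 1 (λ N → N :* con half :+ N :* con half := N) refl N ⟩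
  N                               ≤⟨ excess ⟩
  (P * ε) * N + S                 ≡⟨ solve 4 (λ P ε N S → (P :* ε) :* N :+ S := (con two :* P :* ε) :* (N :* con half) :+ S) refl P ε N S ⟩
  (two * P * ε) * (N * half) + S  ≤⟨ ℚP.+-monoˡ-≤ S (ℚP.*-monoʳ-≤-nonNeg (N * half) {{halfN-nonNeg}} 2Pε≤1) ⟩
  1ℚ * (N * half) + S             ≡⟨ cong (_+ S) (ℚP.*-identityˡ (N * half)) ⟩
  N * half + S                    ∎)
  where
  open ℚP.≤-Reasoning
  open +-*-Solver using (solve; _:=_; _:+_; _:*_; con)
  halfN-nonNeg : NonNegative (N * half)
  halfN-nonNeg = ℚP.nonNeg*nonNeg⇒nonNeg N {{nonNegative 0≤N}} half

stretchBound : ∀ {P K M N β} → 0ℚ ≤ P → 0ℚ ≤ K → M ≡ four * K + 1ℚ → N ≡ M * (1ℚ + P) →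
               N * half ≤ (1ℚ + P) * K + β * M → (1ℚ + P) * quarter ≤ β
stretchBound {P} {K} {_} {_} {β} 0≤P 0≤K refl refl halfN≤ =
  ℚP.*-cancelʳ-≤-pos M {{M-pos}} (+-cancelˡ-≤ ((1ℚ + P) * K) (begin
    (1ℚ + P) * K + (1ℚ + P) * quarter * M                        ≤⟨ x≤x+y _ (ℚP.nonNegative⁻¹ ((1ℚ + P) * quarter) {{share-nonNeg}}) ⟩
    (1ℚ + P) * K + (1ℚ + P) * quarter * M + (1ℚ + P) * quarter   ≡⟨ solve 2 (λ P K →
        (con 1ℚ :+ P) :* K :+ (con 1ℚ :+ P) :* con quarter :* (con four :* K :+ con 1ℚ) :+ (con 1ℚ :+ P) :* con quarter
     := (con four :* K :+ con 1ℚ) :* (con 1ℚ :+ P) :* con half) refl P K ⟩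
    M * (1ℚ + P) * half                                          ≤⟨ halfN≤ ⟩
    (1ℚ + P) * K + β * M                                         ∎))
  where
  open ℚP.≤-Reasoning
  open +-*-Solver using (solve; _:=_; _:+_; _:*_; con)
  M : ℚ
  M = four * K + 1ℚ
  instance
    P-nonNeg : NonNegative P
    P-nonNeg = nonNegative 0≤P
    K-nonNeg : NonNegative K
    K-nonNeg = nonNegative 0≤K
  M-pos : Positive M
  M-pos = ℚP.nonNeg+pos⇒pos (four * K) {{ℚP.nonNeg*nonNeg⇒nonNeg four K}} 1ℚ
  share-nonNeg : NonNegative ((1ℚ + P) * quarter)
  share-nonNeg = ℚP.nonNeg*nonNeg⇒nonNeg (1ℚ + P) {{ℚP.nonNeg+nonNeg⇒nonNeg 1ℚ P}} quarter

inverseBound : ∀ Q ε (ε>0 : 0ℚ < ε) → 1ℚ ≤ two * Q * ε → _÷_ eighth ε {{>-nonZero ε>0}} ≤ Q * quarter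
inverseBound Q ε ε>0 1≤2Qε =
  ℚP.*-cancelʳ-≤-pos ε {{positive ε>0}} (subst₂ _≤_ eighth≡ scaled (ℚP.*-monoʳ-≤-nonNeg eighth 1≤2Qε))
  where
  open +-*-Solver using (solve; _:=_; _:+_; _:*_; con)
  eighth≡ : 1ℚ * eighth ≡ _÷_ eighth ε {{>-nonZero ε>0}} * ε
  eighth≡ = sym (begin
    eighth * 1/ ε * ε    ≡⟨ ℚP.*-assoc eighth (1/ ε) ε ⟩
    eighth * (1/ ε * ε)  ≡⟨ cong (eighth *_) (ℚP.*-inverseˡ ε) ⟩
    eighth * 1ℚ          ≡⟨ ℚP.*-comm eighth 1ℚ ⟩
    1ℚ * eighth          ∎)
    where
    open ≡-Reasoning
    instance
      ε-nonZero : NonZero ε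
      ε-nonZero = >-nonZero ε>0
  scaled : two * Q * ε * eighth ≡ Q * quarter * ε
  scaled = solve 2 (λ Q ε → con two :* Q :* ε :* con eighth := Q :* con quarter :* ε) refl Q ε

-- Choosing p from ε

fraction·denominator : ∀ a d-1 .(c : Coprime a (suc d-1)) → mkℚ (+ a) d-1 c * ⟦ suc d-1 ⟧ ≡ ⟦ a ⟧
fraction·denominator a d-1 c = ℚP.toℚᵘ-injective (begin
  toℚᵘ (ε * ⟦ d ⟧)                        ≈⟨ ℚP.toℚᵘ-homo-* ε ⟦ d ⟧ ⟩
  toℚᵘ ε ℚᵘ.* toℚᵘ ⟦ d ⟧                  ≡⟨ cong (toℚᵘ ε ℚᵘ.*_) (toℚᵘ-⟦⟧ d) ⟩
  ℚᵘ.mkℚᵘ (+ a) d-1 ℚᵘ.* ℚᵘ.mkℚᵘ (+ d) 0  ≈⟨ ℚᵘ.*≡* cross ⟩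
  ℚᵘ.mkℚᵘ (+ a) 0                         ≡⟨ toℚᵘ-⟦⟧ a ⟨
  toℚᵘ ⟦ a ⟧                              ∎)
  where
  open ℚᵘP.≃-Reasoning
  ε = mkℚ (+ a) d-1 c
  d = suc d-1
  cross : (+ a ℤ.* + d) ℤ.* + 1 ≡ + a ℤ.* + (d ℕ.* 1)
  cross = trans (ℤP.*-identityʳ (+ a ℤ.* + d)) (cong (λ x → + a ℤ.* + x) (sym (ℕP.*-identityʳ d)))

clearDenominator : ∀ a d-1 .(c : Coprime a (suc d-1)) k →
                   ⟦ k ⟧ * mkℚ (+ a) d-1 c * ⟦ suc d-1 ⟧ ≡ ⟦ k ℕ.* a ⟧
clearDenominator a d-1 c k = begin
  ⟦ k ⟧ * ε * ⟦ d ⟧    ≡⟨ ℚP.*-assoc ⟦ k ⟧ ε ⟦ d ⟧ ⟩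
  ⟦ k ⟧ * (ε * ⟦ d ⟧)  ≡⟨ cong (⟦ k ⟧ *_) (fraction·denominator a d-1 c) ⟩
  ⟦ k ⟧ * ⟦ a ⟧        ≡⟨ ⟦⟧-* k a ⟨
  ⟦ k ℕ.* a ⟧          ∎
  where
  open ≡-Reasoning
  ε = mkℚ (+ a) d-1 c
  d = suc d-1

-- p = ⌊d/(2a)⌋ = ⌊1/(2ε)⌋ satisfies p ≥ 2 (as ε < 1/4), 2pε ≤ 1 and 1 ≤ 2(p+1)ε
chooseP : ∀ ε → 0ℚ < ε → ε < quarter →
          Σ ℕ λ p → 2 ℕ.≤ p × two * ⟦ p ⟧ * ε ≤ 1ℚ × 1ℚ ≤ two * (1ℚ + ⟦ p ⟧) * ε
chooseP (mkℚ (+ zero) _ _) (*<* (ℤ.+<+ ())) _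
chooseP (mkℚ ℤ.-[1+ _ ] _ _) (*<* ()) _
chooseP (mkℚ (+ suc a-1) d-1 c) _ (*<* 4a<d) = p , 2≤p , 2pε≤1 , 1≤2[1+p]ε
  where
  open ℕSolver.+-*-Solver using (solve; _:=_; _:*_; con)
  a d p : ℕ
  a = suc a-1
  d = suc d-1
  p = d DivMod./ (2 ℕ.* a)
  ε = mkℚ (+ a) d-1 c
  instance
    ⟦d⟧-pos : Positive ⟦ d ⟧
    ⟦d⟧-pos = ⟦suc⟧-pos d-1
  -- k·ε compared with 1 is k·a compared with d
  below : ∀ k → k ℕ.* a ℕ.≤ d → ⟦ k ⟧ * ε ≤ 1ℚ
  below k ka≤d = ℚP.*-cancelʳ-≤-pos ⟦ d ⟧
    (subst₂ _≤_ (sym (clearDenominator a d-1 c k)) (sym (ℚP.*-identityˡ ⟦ d ⟧)) (⟦⟧-mono-≤ ka≤d))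
  above : ∀ k → d ℕ.≤ k ℕ.* a → 1ℚ ≤ ⟦ k ⟧ * ε
  above k d≤ka = ℚP.*-cancelʳ-≤-pos ⟦ d ⟧
    (subst₂ _≤_ (sym (ℚP.*-identityˡ ⟦ d ⟧)) (sym (clearDenominator a d-1 c k)) (⟦⟧-mono-≤ d≤ka))
  regroup : ∀ k → k ℕ.* (2 ℕ.* a) ≡ (2 ℕ.* k) ℕ.* a
  regroup k = solve 2 (λ k a → k :* (con 2 :* a) := (con 2 :* k) :* a) refl k a
  4a≤d : 2 ℕ.* (2 ℕ.* a) ℕ.≤ d
  4a≤d = ℕP.≤-trans (ℕP.≤-reflexive (solve 1 (λ a → con 2 :* (con 2 :* a) := a :* con 4) refl a))
           (ℕP.≤-trans (ℕP.<⇒≤ (ℤP.drop‿+<+ (subst₂ ℤ._<_ (sym (ℤP.pos-* a 4)) (sym (ℤP.pos-* 1 d)) 4a<d)))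
             (ℕP.≤-reflexive (ℕP.*-identityˡ d)))
  2≤p : 2 ℕ.≤ p
  2≤p = subst (ℕ._≤ p) (DivMod.m*n/n≡m 2 (2 ℕ.* a)) (DivMod./-monoˡ-≤ (2 ℕ.* a) 4a≤d)
  2pε≤1 : two * ⟦ p ⟧ * ε ≤ 1ℚ
  2pε≤1 = subst (λ x → x * ε ≤ 1ℚ) (⟦⟧-* 2 p)
    (below (2 ℕ.* p) (subst (ℕ._≤ d) (regroup p) (DivMod.m/n*n≤m d (2 ℕ.* a))))
  1≤2[1+p]ε : 1ℚ ≤ two * (1ℚ + ⟦ p ⟧) * ε
  1≤2[1+p]ε = subst (λ x → 1ℚ ≤ x * ε) (trans (⟦⟧-* 2 (suc p)) (cong (two *_) (⟦⟧-+ 1 p)))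
    (above (2 ℕ.* suc p) (subst (d ℕ.≤_) (regroup (suc p)) (ℕP.<⇒≤ d<[1+p]2a)))
    where
    d<[1+p]2a : d ℕ.< suc p ℕ.* (2 ℕ.* a)
    d<[1+p]2a = subst (ℕ._< suc p ℕ.* (2 ℕ.* a)) (sym (DivMod.m≡m%n+[m/n]*n d (2 ℕ.* a)))
                  (ℕP.+-monoˡ-< (p ℕ.* (2 ℕ.* a)) (DivMod.m%n<n d (2 ℕ.* a)))

-- The lower bound

-- Bin stretch 1 + ε with 2pε ≤ 1 forces colour stretch at least (p + 1)/4:
-- run the assumed algorithm on the hard instance with n = (4K + 1)·q pairs.
colourStretchBound : ∀ p → 2 ℕ.≤ p → ∀ ε β → two * ⟦ p ⟧ * ε ≤ 1ℚ →
                     AllAdmit (1ℚ + ε) β → (1ℚ + ⟦ p ⟧) * quarter ≤ β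
colourStretchBound p 2≤p ε β 2pε≤1 (K , admits) =
  stretchBound (nonNeg p) (nonNeg K) ⟦m⟧≡ ⟦n⟧≡
    (halve {N = ⟦ n ⟧} {⟦ p ⟧} {ε} (nonNeg n) 2pε≤1
      (excessBound {P = ⟦ p ⟧} {ε} {K = ⟦ K ⟧} {β} {M = ⟦ m ⟧} (nonNeg p) counting binsApprox colourApprox))
  where
  open HardInstance p 2≤p
  nonNeg : ∀ k → 0ℚ ≤ ⟦ k ⟧
  nonNeg k = ℚP.nonNegative⁻¹ ⟦ k ⟧ {{⟦⟧-nonNeg k}}
  m n : ℕ
  m = 4 ℕ.* K ℕ.+ 1
  n = m ℕ.* q
  ⟦m⟧≡ : ⟦ m ⟧ ≡ four * ⟦ K ⟧ + 1ℚ
  ⟦m⟧≡ = trans (⟦⟧-+ (4 ℕ.* K) 1) (cong (_+ 1ℚ) (⟦⟧-* 4 K))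
  ⟦n⟧≡ : ⟦ n ⟧ ≡ ⟦ m ⟧ * (1ℚ + ⟦ p ⟧)
  ⟦n⟧≡ = trans (⟦⟧-* m q) (cong (⟦ m ⟧ *_) (⟦⟧-+ 1 p))
  packing : Σ (Packing (hardInstance n)) (IsApprox (1ℚ + ε) β K (hardInstance n))
  packing = admits (hardInstance n) (hardInstance-valid n)
  P : Packing (hardInstance n)
  P = proj₁ packing
  binsApprox : ⟦ numBins P ⟧ ≤ (1ℚ + ε) * ⟦ n ⟧ + ⟦ K ⟧
  binsApprox = proj₁ (proj₂ packing) n (hardInstance-OPT n)
  colourApprox : ⟦ numBinsWithColour 1 P ⟧ ≤ β * ⟦ m ⟧ + ⟦ K ⟧
  colourApprox = proj₂ (proj₂ packing) 1 m (smallClass-OPT m)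
  counting : ⟦ n ⟧ * (1ℚ + ⟦ p ⟧) ≤ ⟦ numBins P ⟧ * ⟦ p ⟧ + ⟦ numBinsWithColour 1 P ⟧
  counting = subst₂ _≤_
    (trans (⟦⟧-* n q) (cong (⟦ n ⟧ *_) (⟦⟧-+ 1 p)))
    (trans (⟦⟧-+ (numBins P ℕ.* p) _) (cong (_+ ⟦ numBinsWithColour 1 P ⟧) (⟦⟧-* (numBins P) p)))
    (⟦⟧-mono-≤ (hardInstance-colourBound n P))

theorem1 : ∃ λ (κ : ℚ) → (0ℚ < κ) ×
    (∀ (ε : ℚ) (ε>0 : 0ℚ < ε) → ε < + 1 / 4 →
      ∀ (β : ℚ) → AllAdmit (1ℚ + ε) β → _÷_ κ ε {{>-nonZero ε>0}} ≤ β)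
theorem1 = eighth , ℚP.positive⁻¹ eighth , lowerBound
  where
  lowerBound : ∀ (ε : ℚ) (ε>0 : 0ℚ < ε) → ε < quarter →
               ∀ (β : ℚ) → AllAdmit (1ℚ + ε) β → _÷_ eighth ε {{>-nonZero ε>0}} ≤ β
  lowerBound ε ε>0 ε<¼ β admits with chooseP ε ε>0 ε<¼
  ... | p , 2≤p , 2pε≤1 , 1≤2[1+p]ε =
    ℚP.≤-trans (inverseBound (1ℚ + ⟦ p ⟧) ε ε>0 1≤2[1+p]ε) (colourStretchBound p 2≤p ε β 2pε≤1 admits)
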